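{- Let $s$ be a string of length $n$ whose last letter is a unique smallest letter $\$$. For any position $p$ of $s$ that is not irreducible, we have $\ell_{p-1} = \ell_p + 1$, and for every $d \ge 0$, if $b_{p-1}[d+1] = 1$ then $b_p[d] = 1$.
   Context: $\mathrm{SA}[0..n-1]$ is the suffix array of $s$ (suffix starting positions in increasing lexicographic order of the suffixes), $\mathrm{ISA}$ its inverse ($\mathrm{SA}[\mathrm{ISA}[p]] = p$). $\mathrm{lcp}(p,q)$ is the length of the longest common prefix of $s[p..n-1]$ and $s[q..n-1]$. $\mathrm{LCP}[0]=0$ and $\mathrm{LCP}[i] = \mathrm{lcp}(\mathrm{SA}[i-1],\mathrm{SA}[i])$ for $i \ge 1$; $\mathrm{PLCP}[p] = \mathrm{LCP}[\mathrm{ISA}[p]]$. The Burrows–Wheeler transform is $\mathrm{BWT}[i] = s[\mathrm{SA}[i]-1]$ if $\mathrm{SA}[i]\ne 0$ and $\mathrm{BWT}[i] = s[n-1]$ otherwise. An index $i$ (and the value $\mathrm{LCP}[i]$) is irreducible if $i = 0$ or $\mathrm{BWT}[i-1] \ne \mathrm{BWT}[i]$; a position $p$ of $s$ is irreducible if the index $\mathrm{ISA}[p]$ is irreducible. For every position $p$, let $\ell_p = \mathrm{PLCP}[p]$ and let $b_p[0..\ell_p-1]$ be the bit array with $b_p[d] = 1$ iff there exists a position $t$ such that $s[t..n-1]$ is lexicographically smaller than $s[p..n-1]$ and $\mathrm{lcp}(t,p) = d$ (equivalently, iff the path from the leaf of $s[p..n-1]$ to the root in the suffix tree contains a left-branching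 node of string depth $d$). -}

module Defs where

open import Data.Nat using (ℕ; zero; suc; _+_; _∸_; _<_; _≤_)
open import Data.List using (List; []; _∷_; length; drop)
open import Data.Product using (Σ; _×_; ∃-syntax)
open import Data.Sum using (_⊎_)
open import Relation.Binary.PropositionalEquality using (_≡_; _≢_)
open import Relation.Nullary using (¬_)

String : Set
String = List ℕ

-- s[i] (0-indexed); returns 0 out of range (only used in range).
charAt : String → ℕ → ℕ
charAt []       _       = 0
charAt (x ∷ _)  zero    = x
charAt (_ ∷ xs) (suc i) = charAt xs i

suf : String → ℕ → String
suf s p = drop p s

data _<ˡ_ : String → String → Set where
  []<∷  : ∀ {y ys} → [] <ˡ (y ∷ ys)
  hd<   : ∀ {x y xs ys} → x < y → (x ∷ xs) <ˡ (y ∷ ys)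
  tl<   : ∀ {x xs ys} → xs <ˡ ys → (x ∷ xs) <ˡ (x ∷ ys)

lcpL : String → String → ℕ
lcpL [] _ = 0
lcpL (_ ∷ _) [] = 0
lcpL (x ∷ xs) (y ∷ ys) with x Data.Nat.≟ y
... | Relation.Nullary.yes _ = suc (lcpL xs ys)
... | Relation.Nullary.no _  = 0

lcp : String → ℕ → ℕ → ℕ
lcp s p q = lcpL (suf s p) (suf s q)

UniqueSentinel : String → Set
UniqueSentinel s = (0 < length s) × (∀ i → i < length s ∸ 1 → charAt s (length s ∸ 1) < charAt s i)

IsSuffixArray : String → (ℕ → ℕ) → Set
IsSuffixArray s SA =
  (∀ i → i < length s → SA i < length s) ×
  (∀ i j → i < j → j < length s → suf s (SA i) <ˡ suf s (SA j)) ×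
  (∀ p → p < length s → ∃[ i ] (i < length s × SA i ≡ p))

IsInverseSA : String → (ℕ → ℕ) → (ℕ → ℕ) → Set
IsInverseSA s SA ISA = ∀ p → p < length s → (ISA p < length s) × (SA (ISA p) ≡ p)

module SuffixStructures (s : String) (SA ISA : ℕ → ℕ) where

  n : ℕ
  n = length s

  LCP : ℕ → ℕ
  LCP zero    = 0
  LCP (suc i) = lcp s (SA i) (SA (suc i))

  PLCP : ℕ → ℕ
  PLCP p = LCP (ISA p)

  ℓ : ℕ → ℕ
  ℓ = PLCP

  BWT : ℕ → ℕ
  BWT i with SA i
  ... | zero  = charAt s (n ∸ 1)
  ... | suc q = charAt s q

  IrreducibleIndex : ℕ → Set
  IrreducibleIndex i = (i ≡ 0) ⊎ (BWT (i ∸ 1) ≢ BWT i)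

  IrreduciblePos : ℕ → Set
  IrreduciblePos p = IrreducibleIndex (ISA p)

  -- b_p[d] = 1 (with d a valid index, d < ℓ_p): there is a position t with
  -- s[t..n-1] lexicographically smaller than s[p..n-1] and lcp(t,p) = d.
  bBit : ℕ → ℕ → Set
  bBit p d = (d < ℓ p) × ∃[ t ] (t < n × suf s t <ˡ suf s p × lcp s t p ≡ d)

-- ℓ_p is the largest lcp of s[p..] with a lexicographically smaller suffix, attained by its
-- suffix-array predecessor. Stripping the first letter sends a smaller suffix of p − 1 sharing
-- a positive prefix with it to a smaller suffix of p, lowering the lcp by one; the unique
-- sentinel guarantees the stripped suffix is nonempty. This gives ℓ_{p−1} ≤ ℓ_p + 1 and the
-- shift of b-bits. Reducibility of p says that the predecessor of s[p..] is preceded by the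
-- same letter s[p − 1] (this excludes p = 0, as $ occurs once), so prepending that letter
-- yields a smaller suffix of p − 1 with lcp ℓ_p + 1.
module Submission where

open import Defs
open import Data.Nat using (ℕ; zero; suc; _+_; _∸_; _<_; _≤_; z≤n; s≤s; _≟_; _<?_)
open import Data.Nat.Properties
open import Data.Product using (_×_; _,_; proj₁; proj₂; ∃-syntax)
open import Data.Sum using (_⊎_; inj₁; inj₂)
open import Data.List using (_∷_; length; drop)
open import Data.Empty using (⊥-elim)
open import Relation.Binary.PropositionalEquality
open import Relation.Binary.Definitions using (tri<; tri≈; tri>)
open import Relation.Nullary using (¬_; yes; no)

<ˡ-irrefl : ∀ {xs} → ¬ (xs <ˡ xs)
<ˡ-irrefl (hd< x<x) = <-irrefl refl x<x
<ˡ-irrefl (tl< xs<xs) = <ˡ-irrefl xs<xs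

<ˡ-trans : ∀ {xs ys zs} → xs <ˡ ys → ys <ˡ zs → xs <ˡ zs
<ˡ-trans []<∷ (hd< _) = []<∷
<ˡ-trans []<∷ (tl< _) = []<∷
<ˡ-trans (hd< x<y) (hd< y<z) = hd< (<-trans x<y y<z)
<ˡ-trans (hd< x<y) (tl< _) = hd< x<y
<ˡ-trans (tl< _) (hd< y<z) = hd< y<z
<ˡ-trans (tl< xs<ys) (tl< ys<zs) = tl< (<ˡ-trans xs<ys ys<zs)

<ˡ-asym : ∀ {xs ys} → xs <ˡ ys → ¬ (ys <ˡ xs)
<ˡ-asym xs<ys ys<xs = <ˡ-irrefl (<ˡ-trans xs<ys ys<xs)

<ˡ-∷⁻ : ∀ {x y xs ys} → (x ∷ xs) <ˡ (y ∷ ys) → x < y ⊎ (x ≡ y × xs <ˡ ys)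
<ˡ-∷⁻ (hd< x<y) = inj₁ x<y
<ˡ-∷⁻ (tl< xs<ys) = inj₂ (refl , xs<ys)

lcpL-∷-≡ : ∀ x xs ys → lcpL (x ∷ xs) (x ∷ ys) ≡ suc (lcpL xs ys)
lcpL-∷-≡ x xs ys with x ≟ x
... | yes _ = refl
... | no x≢x = ⊥-elim (x≢x refl)

lcpL-∷-≢ : ∀ {x y} xs ys → x ≢ y → lcpL (x ∷ xs) (y ∷ ys) ≡ 0
lcpL-∷-≢ {x} {y} xs ys x≢y with x ≟ y
... | yes x≡y = ⊥-elim (x≢y x≡y)
... | no _ = refl

lcpL-monoˡ-<ˡ : ∀ {xs ys zs} → xs <ˡ ys → ys <ˡ zs → lcpL xs zs ≤ lcpL ys zs
lcpL-monoˡ-<ˡ []<∷ _ = z≤n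
lcpL-monoˡ-<ˡ (hd< {xs = xs} x<y) (hd< {ys = zs} y<z)
  rewrite lcpL-∷-≢ xs zs (<⇒≢ (<-trans x<y y<z)) = z≤n
lcpL-monoˡ-<ˡ (hd< {xs = xs} x<y) (tl< {ys = zs} _)
  rewrite lcpL-∷-≢ xs zs (<⇒≢ x<y) = z≤n
lcpL-monoˡ-<ˡ (tl< {xs = xs} _) (hd< {ys = zs} x<z)
  rewrite lcpL-∷-≢ xs zs (<⇒≢ x<z) = z≤n
lcpL-monoˡ-<ˡ (tl< {x} {xs} {ys} xs<ys) (tl< {_} {_} {zs} ys<zs)
  rewrite lcpL-∷-≡ x xs zs | lcpL-∷-≡ x ys zs = s≤s (lcpL-monoˡ-<ˡ xs<ys ys<zs)

module _ (s : String) where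

  suf-∷ : ∀ {p} → p < length s → suf s p ≡ charAt s p ∷ suf s (suc p)
  suf-∷ = go s
    where
      go : ∀ xs {p} → p < length xs → drop p xs ≡ charAt xs p ∷ drop (suc p) xs
      go (x ∷ xs) {zero} _ = refl
      go (x ∷ xs) {suc p} (s≤s p<n) = go xs p<n

  suf-<ˡ⁻ : ∀ {a b} → a < length s → b < length s → suf s a <ˡ suf s b →
    charAt s a < charAt s b ⊎ (charAt s a ≡ charAt s b × suf s (suc a) <ˡ suf s (suc b))
  suf-<ˡ⁻ a<n b<n a<b = <ˡ-∷⁻ (subst₂ _<ˡ_ (suf-∷ a<n) (suf-∷ b<n) a<b)

  suf-<ˡ⁺ : ∀ {a b} → a < length s → b < length s → charAt s a ≡ charAt s b →
    suf s (suc a) <ˡ suf s (suc b) → suf s a <ˡ suf s b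
  suf-<ˡ⁺ a<n b<n ca≡cb lt =
    subst₂ _<ˡ_ (sym (suf-∷ a<n)) (trans (cong (_∷ _) ca≡cb) (sym (suf-∷ b<n))) (tl< lt)

  lcp-∷-≡ : ∀ {a b} → a < length s → b < length s → charAt s a ≡ charAt s b →
    lcp s a b ≡ suc (lcp s (suc a) (suc b))
  lcp-∷-≡ {a} {b} a<n b<n ca≡cb = begin
    lcpL (suf s a) (suf s b)
      ≡⟨ cong₂ lcpL (suf-∷ a<n) (trans (suf-∷ b<n) (cong (_∷ _) (sym ca≡cb))) ⟩
    lcpL (charAt s a ∷ suf s (suc a)) (charAt s a ∷ suf s (suc b))
      ≡⟨ lcpL-∷-≡ _ _ _ ⟩
    suc (lcp s (suc a) (suc b)) ∎
    where open ≡-Reasoning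

  lcp-∷-≢ : ∀ {a b} → a < length s → b < length s → charAt s a ≢ charAt s b → lcp s a b ≡ 0
  lcp-∷-≢ a<n b<n ca≢cb =
    trans (cong₂ lcpL (suf-∷ a<n) (suf-∷ b<n)) (lcpL-∷-≢ _ _ ca≢cb)

module SuffixArrayProperties (s : String) (SA ISA : ℕ → ℕ)
  (isSA : IsSuffixArray s SA) (inv : IsInverseSA s SA ISA) where
  open SuffixStructures s SA ISA

  SA<n : ∀ {i} → i < n → SA i < n
  SA<n = proj₁ isSA _

  SA-sorted : ∀ {i j} → i < j → j < n → suf s (SA i) <ˡ suf s (SA j)
  SA-sorted = proj₁ (proj₂ isSA) _ _

  ISA<n : ∀ {p} → p < n → ISA p < n
  ISA<n p<n = proj₁ (inv _ p<n)

  SA-ISA : ∀ {p} → p < n → SA (ISA p) ≡ p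
  SA-ISA p<n = proj₂ (inv _ p<n)

  <ˡ⇒ISA< : ∀ {t p} → t < n → p < n → suf s t <ˡ suf s p → ISA t < ISA p
  <ˡ⇒ISA< {t} {p} t<n p<n t<p with <-cmp (ISA t) (ISA p)
  ... | tri< lt _ _ = lt
  ... | tri≈ _ eq _ = ⊥-elim (<ˡ-irrefl (subst (λ u → suf s u <ˡ suf s p) t≡p t<p))
    where
      t≡p : t ≡ p
      t≡p = trans (sym (SA-ISA t<n)) (trans (cong SA eq) (SA-ISA p<n))
  ... | tri> _ _ gt = ⊥-elim (<ˡ-asym t<p
    (subst₂ (λ u v → suf s u <ˡ suf s v) (SA-ISA p<n) (SA-ISA t<n) (SA-sorted gt (ISA<n t<n))))

  lcp-SA≤LCP : ∀ {i j} → i < j → j < n → lcp s (SA i) (SA j) ≤ LCP j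
  lcp-SA≤LCP {i} {suc k} (s≤s i≤k) k+1<n with m≤n⇒m<n∨m≡n i≤k
  ... | inj₁ i<k = lcpL-monoˡ-<ˡ (SA-sorted i<k (<⇒≤ k+1<n)) (SA-sorted (n<1+n k) k+1<n)
  ... | inj₂ refl = ≤-refl

  lcp≤ℓ : ∀ {t p} → t < n → p < n → suf s t <ˡ suf s p → lcp s t p ≤ ℓ p
  lcp≤ℓ {t} {p} t<n p<n t<p = subst₂ (λ u v → lcp s u v ≤ ℓ p) (SA-ISA t<n) (SA-ISA p<n)
    (lcp-SA≤LCP (<ˡ⇒ISA< t<n p<n t<p) (ISA<n p<n))

  predecessor-suffix : ∀ {p i} → p < n → ISA p ≡ suc i →
    SA i < n × suf s (SA i) <ˡ suf s p × ℓ p ≡ lcp s (SA i) p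
  predecessor-suffix {p} {i} p<n ISAp≡i+1 =
    SA<n (<⇒≤ i+1<n) ,
    subst (λ v → suf s (SA i) <ˡ suf s v) SA[i+1]≡p (SA-sorted (n<1+n i) i+1<n) ,
    trans (cong LCP ISAp≡i+1) (cong (lcp s (SA i)) SA[i+1]≡p)
    where
      i+1<n : suc i < n
      i+1<n = subst (_< n) ISAp≡i+1 (ISA<n p<n)
      SA[i+1]≡p : SA (suc i) ≡ p
      SA[i+1]≡p = trans (cong SA (sym ISAp≡i+1)) (SA-ISA p<n)

  ℓ-attained : ∀ {p} → p < n → ℓ p ≡ 0 ⊎ ∃[ u ] (u < n × suf s u <ˡ suf s p × lcp s u p ≡ ℓ p)
  ℓ-attained {p} p<n = by-cases (ISA p) refl
    where
      by-cases : ∀ j → ISA p ≡ j → ℓ p ≡ 0 ⊎ ∃[ u ] (u < n × suf s u <ˡ suf s p × lcp s u p ≡ ℓ p)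
      by-cases zero ISAp≡0 = inj₁ (cong LCP ISAp≡0)
      by-cases (suc i) ISAp≡i+1 with predecessor-suffix p<n ISAp≡i+1
      ... | SAi<n , SAi<p , ℓp≡ = inj₂ (SA i , SAi<n , SAi<p , sym ℓp≡)

module SentinelProperties (s : String) (us : UniqueSentinel s) (SA ISA : ℕ → ℕ)
  (isSA : IsSuffixArray s SA) (inv : IsInverseSA s SA ISA) where
  open SuffixStructures s SA ISA
  open SuffixArrayProperties s SA ISA isSA inv

  sentinel-unique : ∀ {q} → suc q < n → charAt s q ≢ charAt s (n ∸ 1)
  sentinel-unique q+1<n eq = <-irrefl (sym eq) (proj₂ us _ (∸-monoˡ-≤ 1 q+1<n))

  letter≡⇒suc<n : ∀ {t p} → t < n → suc p < n → charAt s t ≡ charAt s p → suc t < n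
  letter≡⇒suc<n {t} t<n p+1<n ct≡cp with suc t <? n
  ... | yes t+1<n = t+1<n
  ... | no t+1≮n = ⊥-elim (sentinel-unique p+1<n (trans (sym ct≡cp) (cong (charAt s) t≡n-1)))
    where
      t≡n-1 : t ≡ n ∸ 1
      t≡n-1 = cong (_∸ 1) (≤-antisym t<n (≮⇒≥ t+1≮n))

  suf-<ˡ-shift : ∀ {t p} → t < n → suc p < n → suf s t <ˡ suf s p →
    lcp s t p ≡ 0 ⊎
    (suc t < n × suf s (suc t) <ˡ suf s (suc p) × lcp s t p ≡ suc (lcp s (suc t) (suc p)))
  suf-<ˡ-shift t<n p+1<n t<p with suf-<ˡ⁻ s t<n (<⇒≤ p+1<n) t<p
  ... | inj₁ ct<cp = inj₁ (lcp-∷-≢ s t<n (<⇒≤ p+1<n) (<⇒≢ ct<cp))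
  ... | inj₂ (ct≡cp , t+1<p+1) =
    inj₂ (letter≡⇒suc<n t<n p+1<n ct≡cp , t+1<p+1 , lcp-∷-≡ s t<n (<⇒≤ p+1<n) ct≡cp)

  precedingLetter : ℕ → ℕ
  precedingLetter zero = charAt s (n ∸ 1)
  precedingLetter (suc q) = charAt s q

  BWT≡precedingLetter : ∀ i → BWT i ≡ precedingLetter (SA i)
  BWT≡precedingLetter i with SA i
  ... | zero = refl
  ... | suc q = refl

  reducible⇒predecessor : ∀ {p} → p < n → ¬ IrreduciblePos p →
    ∃[ i ] (ISA p ≡ suc i × precedingLetter (SA i) ≡ precedingLetter p)
  reducible⇒predecessor {p} p<n red with ISA p | SA-ISA p<n | red
  ... | zero | _ | red₀ = ⊥-elim (red₀ (inj₁ refl))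
  ... | suc i | SA[i+1]≡p | red₁ with BWT i ≟ BWT (suc i)
  ...   | no BWT≢ = ⊥-elim (red₁ (inj₂ BWT≢))
  ...   | yes BWT≡ = i , refl , (begin
    precedingLetter (SA i)       ≡⟨ sym (BWT≡precedingLetter i) ⟩
    BWT i                        ≡⟨ BWT≡ ⟩
    BWT (suc i)                  ≡⟨ BWT≡precedingLetter (suc i) ⟩
    precedingLetter (SA (suc i)) ≡⟨ cong precedingLetter SA[i+1]≡p ⟩
    precedingLetter p            ∎)
    where open ≡-Reasoning

  ¬¬irreducible-0 : 0 < n → ¬ ¬ IrreduciblePos 0
  ¬¬irreducible-0 0<n red with reducible⇒predecessor 0<n red
  ... | i , ISA0≡i+1 , letter≡ with SA i | predecessor-suffix 0<n ISA0≡i+1 | letter≡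
  ...   | zero | _ , 0<0 , _ | _ = <ˡ-irrefl 0<0
  ...   | suc q | q+1<n , _ | cq≡$ = sentinel-unique q+1<n cq≡$

  reducible⇒extends : ∀ {p} → suc p < n → ¬ IrreduciblePos (suc p) →
    ∃[ q ] (q < n × suf s q <ˡ suf s p × lcp s q p ≡ suc (ℓ (suc p)))
  reducible⇒extends {p} p+1<n red with reducible⇒predecessor p+1<n red
  ... | i , ISA≡i+1 , letter≡ with SA i | predecessor-suffix p+1<n ISA≡i+1 | letter≡
  ...   | zero | _ | $≡cp = ⊥-elim (sentinel-unique p+1<n (sym $≡cp))
  ...   | suc q | q+1<n , q+1<p+1 , ℓ≡ | cq≡cp =
    q , <⇒≤ q+1<n , suf-<ˡ⁺ s (<⇒≤ q+1<n) (<⇒≤ p+1<n) cq≡cp q+1<p+1 ,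
    trans (lcp-∷-≡ s (<⇒≤ q+1<n) (<⇒≤ p+1<n) cq≡cp) (cong suc (sym ℓ≡))

  lcp≤suc-ℓ-suc : ∀ {t p} → t < n → suc p < n → suf s t <ˡ suf s p → lcp s t p ≤ suc (ℓ (suc p))
  lcp≤suc-ℓ-suc t<n p+1<n t<p with suf-<ˡ-shift t<n p+1<n t<p
  ... | inj₁ lcp≡0 = subst (_≤ _) (sym lcp≡0) z≤n
  ... | inj₂ (t+1<n , t+1<p+1 , lcp≡) = subst (_≤ _) (sym lcp≡) (s≤s (lcp≤ℓ t+1<n p+1<n t+1<p+1))

  ℓ≤suc-ℓ-suc : ∀ {p} → suc p < n → ℓ p ≤ suc (ℓ (suc p))
  ℓ≤suc-ℓ-suc {p} p+1<n with ℓ-attained (<⇒≤ p+1<n)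
  ... | inj₁ ℓ≡0 = subst (_≤ suc (ℓ (suc p))) (sym ℓ≡0) z≤n
  ... | inj₂ (u , u<n , u<p , lcp≡ℓ) = subst (_≤ suc (ℓ (suc p))) lcp≡ℓ (lcp≤suc-ℓ-suc u<n p+1<n u<p)

  suc-ℓ-suc≤ℓ : ∀ {p} → suc p < n → ¬ IrreduciblePos (suc p) → suc (ℓ (suc p)) ≤ ℓ p
  suc-ℓ-suc≤ℓ {p} p+1<n red with reducible⇒extends p+1<n red
  ... | q , q<n , q<p , lcp≡ = subst (_≤ ℓ p) lcp≡ (lcp≤ℓ q<n (<⇒≤ p+1<n) q<p)

  bBit-shift : ∀ {p d} → suc p < n → bBit p (suc d) → bBit (suc p) d
  bBit-shift p+1<n (d+1<ℓ , t , t<n , t<p , lcp≡d+1) with suf-<ˡ-shift t<n p+1<n t<p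
  ... | inj₁ lcp≡0 with trans (sym lcp≡0) lcp≡d+1
  ...   | ()
  bBit-shift p+1<n (d+1<ℓ , t , t<n , t<p , lcp≡d+1) | inj₂ (t+1<n , t+1<p+1 , lcp≡) =
    ≤-pred (≤-trans d+1<ℓ (ℓ≤suc-ℓ-suc p+1<n)) , suc t , t+1<n , t+1<p+1 ,
    suc-injective (trans (sym lcp≡) lcp≡d+1)

lemma4 : (s : String) → UniqueSentinel s →
    (SA ISA : ℕ → ℕ) → IsSuffixArray s SA → IsInverseSA s SA ISA →
    (p : ℕ) → p < length s → ¬ SuffixStructures.IrreduciblePos s SA ISA p →
    (SuffixStructures.ℓ s SA ISA (p ∸ 1) ≡ SuffixStructures.ℓ s SA ISA p + 1) ×
    ((d : ℕ) → SuffixStructures.bBit s SA ISA (p ∸ 1) (suc d) → SuffixStructures.bBit s SA ISA p d)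
lemma4 s us SA ISA isSA inv zero 0<n red = ⊥-elim (¬¬irreducible-0 0<n red)
  where open SentinelProperties s us SA ISA isSA inv
lemma4 s us SA ISA isSA inv (suc p) p+1<n red =
  trans (≤-antisym (ℓ≤suc-ℓ-suc p+1<n) (suc-ℓ-suc≤ℓ p+1<n red)) (+-comm 1 _) ,
  λ _ → bBit-shift p+1<n
  where open SentinelProperties s us SA ISA isSA inv
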